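{- Let $L=(S,A,\to)$ be a labelled transition system. For every $x,y\in\{o,b\}$ and $\bar s,\bar t\in S$, we have $\bar s\,\underline{\leftrightarrow}_{(x,y)}\,\bar t$ if and only if $\bar s\,R\,\bar t$ for some symmetric relation $R\subseteq S\times S$ satisfying: whenever $s\,R\,t$ and $s\xrightarrow{a}s'$, either $a=\tau$ and $s'\,R\,t$, or there exist states $t_1,t_2,t'$ such that $t\Longrightarrow_{x,R,s}t_1\xrightarrow{a}t_2\Longrightarrow_{y,R,s'}t'$ and $s'\,R\,t'$.
   Context: LTS $L=(S,A,\to)$: states $S$, actions $A$ containing the internal action $\tau$, $\to\subseteq S\times A\times S$ written $s\xrightarrow{a}t$; $\twoheadrightarrow$ is the reflexive-transitive closure of $\xrightarrow{\tau}$. For $R\subseteq S\times S$ and $s,s',t\in S$: $s\twoheadrightarrow_{o,R,t}s'$ iff $s\twoheadrightarrow s'$; $s\twoheadrightarrow_{b,R,t}s'$ iff $s\twoheadrightarrow s'$, $t\,R\,s$ and $t\,R\,s'$. Further, $s\Longrightarrow_{o,R,t}s'$ iff $s\twoheadrightarrow s'$, and $s\Longrightarrow_{b,R,t}s'$ iff there is a finite sequence $s=s_0\xrightarrow{\tau}s_1\xrightarrow{\tau}\cdots\xrightarrow{\tau}s_n=s'$ with $t\,R\,s_i$ for all $i$. For $x,y\in\{o,b\}$ a symmetric relation $R$ is an $(x,y)$-generic bisimulation if whenever $s\,R\,t$ and $s\xrightarrow{a}s'$, either $a=\tau$ and $s'\,R\,t$, or there exist $t_1,t_2,t'$ with $t\twoheadrightarrow_{x,R,s}t_1\xrightarrow{a}t_2\twoheadrightarrow_{y,R,s'}t'$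 and $s'\,R\,t'$. $s\,\underline{\leftrightarrow}_{(x,y)}\,t$ iff some $(x,y)$-generic bisimulation relates $s$ and $t$. -}

module Defs where

open import Level using (Level; _⊔_; suc)
open import Data.Product using (Σ; ∃; ∃-syntax; _×_; _,_)
open import Data.Sum using (_⊎_)
open import Relation.Binary.PropositionalEquality using (_≡_)
open import Relation.Binary.Construct.Closure.ReflexiveTransitive using (Star)

record LTS (ℓs ℓa ℓt : Level) : Set (Level.suc (ℓs ⊔ ℓa ⊔ ℓt)) where
  field
    State  : Set ℓs
    Action : Set ℓa
    τ      : Action
    _─[_]→_ : State → Action → State → Set ℓt

-- The two modes: o (ordinary / weak) and b (branching).
data Mode : Set where
  o b : Mode

module _ {ℓs ℓa ℓt : Level} (L : LTS ℓs ℓa ℓt) where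
  open LTS L

  _─τ→_ : State → State → Set ℓt
  s ─τ→ s' = s ─[ τ ]→ s'

  _↠_ : State → State → Set (ℓs ⊔ ℓt)
  _↠_ = Star _─τ→_

  Rel₂ : (ℓ : Level) → Set (ℓs ⊔ Level.suc ℓ)
  Rel₂ ℓ = State → State → Set ℓ

  Symmetric₂ : {ℓ : Level} → Rel₂ ℓ → Set (ℓs ⊔ ℓ)
  Symmetric₂ R = ∀ {s t} → R s t → R t s

  ↠[_,_,_] : {ℓ : Level} → Mode → Rel₂ ℓ → State → State → State → Set (ℓs ⊔ ℓt ⊔ ℓ)
  ↠[_,_,_] {ℓ} o R t s s' = Level.Lift ℓ (s ↠ s')
  ↠[_,_,_] {ℓ} b R t s s' = Level.Lift (ℓs ⊔ ℓt ⊔ ℓ) ((s ↠ s') × R t s × R t s')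

  data TauPathRel {ℓ : Level} (R : Rel₂ ℓ) (t : State) : State → State → Set (ℓs ⊔ ℓt ⊔ ℓ) where
    done : ∀ {s} → R t s → TauPathRel R t s s
    step : ∀ {s s₁ s'} → R t s → s ─τ→ s₁ → TauPathRel R t s₁ s' → TauPathRel R t s s'

  ⟹[_,_,_] : {ℓ : Level} → Mode → Rel₂ ℓ → State → State → State → Set (ℓs ⊔ ℓt ⊔ ℓ)
  ⟹[_,_,_] {ℓ} o R t s s' = Level.Lift ℓ (s ↠ s')
  ⟹[_,_,_] b R t s s' = TauPathRel R t s s'

  Transfer : {ℓ : Level}
           → (Mode → Rel₂ ℓ → State → State → State → Set (ℓs ⊔ ℓt ⊔ ℓ))
           → Mode → Mode → Rel₂ ℓ → Set (ℓs ⊔ ℓa ⊔ ℓt ⊔ ℓ)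
  Transfer Cl x y R =
    ∀ {s t s' a} → R s t → s ─[ a ]→ s' →
      ((a ≡ τ) × R s' t)
      ⊎ (∃[ t₁ ] ∃[ t₂ ] ∃[ t' ]
           (Cl x R s t t₁ × t₁ ─[ a ]→ t₂ × Cl y R s' t₂ t' × R s' t'))

  IsGenericBisim : {ℓ : Level} → Mode → Mode → Rel₂ ℓ → Set (ℓs ⊔ ℓa ⊔ ℓt ⊔ ℓ)
  IsGenericBisim x y R = Symmetric₂ R × Transfer ↠[_,_,_] x y R

  IsGenericBisim⟹ : {ℓ : Level} → Mode → Mode → Rel₂ ℓ → Set (ℓs ⊔ ℓa ⊔ ℓt ⊔ ℓ)
  IsGenericBisim⟹ x y R = Symmetric₂ R × Transfer ⟹[_,_,_] x y R

  GenBisimilar : Mode → Mode → State → State → Set (Level.suc (ℓs ⊔ ℓt) ⊔ ℓa)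
  GenBisimilar x y s t = ∃[ R ] (IsGenericBisim {ℓs ⊔ ℓt} x y R × R s t)

-- Closing an (x,y)-bisimulation R under stuttering (adding every state on a
-- τ-path between two R-partners of a state) yields again an (x,y)-bisimulation.
-- Iterating this closure ω times gives a bisimulation in which every state of a
-- branching τ-path between two partners is itself a partner, so the transfer
-- condition holds with the stronger ⟹ in place of ↠. The converse is immediate,
-- since a ⟹-path is in particular a ↠-path with related end points.
module Submission where

open import Defs
open import Level using (Level; _⊔_; lift)
open import Data.Nat using (ℕ; zero; suc)
open import Data.Product using (∃-syntax; _×_; _,_; proj₁; proj₂)
open import Data.Sum using (_⊎_; inj₁; inj₂; [_,_])
open import Function using (id)
open import Function.Bundles using (_⇔_; mk⇔)
open import Relation.Binary.Core using (_⇒_)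
open import Relation.Binary.PropositionalEquality using (_≡_; refl)
open import Relation.Binary.Construct.Closure.ReflexiveTransitive using (ε; _◅_; _◅◅_)

module _ {ℓs ℓa ℓt : Level} (L : LTS ℓs ℓa ℓt) where
  open LTS L

  private
    Rel : (ℓ : Level) → Set (ℓs ⊔ Level.suc ℓ)
    Rel = Rel₂ L

    infix 4 _↠τ_
    _↠τ_ : State → State → Set (ℓs ⊔ ℓt)
    _↠τ_ = _↠_ L

    ↠⟨_,_,_⟩ ⟹⟨_,_,_⟩ : {ℓ : Level} → Mode → Rel ℓ → State → State → State → Set (ℓs ⊔ ℓt ⊔ ℓ)
    ↠⟨_,_,_⟩ = ↠[_,_,_] L
    ⟹⟨_,_,_⟩ = ⟹[_,_,_] L

    Transfer↠ Transfer⟹ : {ℓ : Level} → Mode → Mode → Rel ℓ → Set (ℓs ⊔ ℓa ⊔ ℓt ⊔ ℓ)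
    Transfer↠ = Transfer L ↠⟨_,_,_⟩
    Transfer⟹ = Transfer L ⟹⟨_,_,_⟩

    variable
      ℓ ℓ′ : Level
      x y : Mode
      a : Action
      P Q R : Rel ℓ
      s s′ t t₁ u v w w′ : State

  ↠-unsnoc : s ↠τ s′ → s ≡ s′ ⊎ ∃[ s₁ ] (s ↠τ s₁ × s₁ ─[ τ ]→ s′)
  ↠-unsnoc ε = inj₁ refl
  ↠-unsnoc (s→s₁ ◅ s₁↠s′) with ↠-unsnoc s₁↠s′
  ... | inj₁ refl = inj₂ (_ , ε , s→s₁)
  ... | inj₂ (s₂ , s₁↠s₂ , s₂→s′) = inj₂ (s₂ , s→s₁ ◅ s₁↠s₂ , s₂→s′)

  ↠⟨⟩⇒↠ : ↠⟨ x , P , t ⟩ s s′ → s ↠τ s′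
  ↠⟨⟩⇒↠ {x = o} (lift s↠s′) = s↠s′
  ↠⟨⟩⇒↠ {x = b} (lift (s↠s′ , _)) = s↠s′

  ↠⇒↠⟨⟩ : P t s → P t s′ → s ↠τ s′ → ↠⟨ x , P , t ⟩ s s′
  ↠⇒↠⟨⟩ {x = o} _ _ s↠s′ = lift s↠s′
  ↠⇒↠⟨⟩ {x = b} tPs tPs′ s↠s′ = lift (s↠s′ , tPs , tPs′)

  ↠⟨⟩-map : (∀ {v} → s ↠τ v → P t v → Q u v) → ↠⟨ x , P , t ⟩ s s′ → ↠⟨ x , Q , u ⟩ s s′
  ↠⟨⟩-map {x = o} f (lift s↠s′) = lift s↠s′
  ↠⟨⟩-map {x = b} f (lift (s↠s′ , tPs , tPs′)) = lift (s↠s′ , f ε tPs , f s↠s′ tPs′)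

  ↠⟨⟩-mono : P ⇒ Q → ↠⟨ x , P , t ⟩ ⇒ ↠⟨ x , Q , t ⟩
  ↠⟨⟩-mono f = ↠⟨⟩-map (λ _ → f)

  ↠⟨⟩-prepend : P t s → s ↠τ s′ → ↠⟨ x , P , t ⟩ s′ u → ↠⟨ x , P , t ⟩ s u
  ↠⟨⟩-prepend {x = o} _ s↠s′ (lift s′↠u) = lift (s↠s′ ◅◅ s′↠u)
  ↠⟨⟩-prepend {x = b} tPs s↠s′ (lift (s′↠u , _ , tPu)) = lift (s↠s′ ◅◅ s′↠u , tPs , tPu)

  -- In mode o the whole path may be kept; in mode b only its first state is
  -- guaranteed to be a partner, and the path is cut back to that state.
  ↠⟨⟩-pivot : ↠⟨ y , P , u ⟩ s s′ → P u s′ →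
              ∃[ ŝ ] (s ↠τ ŝ × P u ŝ × (∀ {v} → Q v ŝ → ↠⟨ y , Q , v ⟩ s ŝ))
  ↠⟨⟩-pivot {y = o} (lift s↠s′) uPs′ = _ , s↠s′ , uPs′ , λ _ → lift s↠s′
  ↠⟨⟩-pivot {y = b} (lift (_ , uPs , _)) _ = _ , ε , uPs , λ vQs → lift (ε , vQs , vQs)

  TauPathRel-mono : P ⇒ Q → TauPathRel L P t ⇒ TauPathRel L Q t
  TauPathRel-mono f (done tPs) = done (f tPs)
  TauPathRel-mono f (step tPs s→s₁ rest) = step (f tPs) s→s₁ (TauPathRel-mono f rest)

  TauPathRel⇒↠⟨b⟩ : TauPathRel L P t ⇒ ↠⟨ b , P , t ⟩
  TauPathRel⇒↠⟨b⟩ (done tPs) = lift (ε , tPs , tPs)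
  TauPathRel⇒↠⟨b⟩ (step tPs s→s₁ rest) with TauPathRel⇒↠⟨b⟩ rest
  ... | lift (s₁↠s′ , _ , tPs′) = lift (s→s₁ ◅ s₁↠s′ , tPs , tPs′)

  ⟹⟨⟩⇒↠⟨⟩ : ∀ z → ⟹⟨ z , P , t ⟩ ⇒ ↠⟨ z , P , t ⟩
  ⟹⟨⟩⇒↠⟨⟩ o = id
  ⟹⟨⟩⇒↠⟨⟩ b = TauPathRel⇒↠⟨b⟩

  Closure : (ℓ : Level) → Set (Level.suc (ℓs ⊔ ℓt ⊔ ℓ))
  Closure ℓ = Mode → Rel ℓ → State → State → State → Set (ℓs ⊔ ℓt ⊔ ℓ)

  Response : Closure ℓ → Mode → Mode → Rel ℓ → State → State → Action → State → Set (ℓs ⊔ ℓa ⊔ ℓt ⊔ ℓ)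
  Response Cl x y R s t a s′ =
    ((a ≡ τ) × R s′ t)
    ⊎ (∃[ t₁ ] ∃[ t₂ ] ∃[ t′ ] (Cl x R s t t₁ × t₁ ─[ a ]→ t₂ × Cl y R s′ t₂ t′ × R s′ t′))

  Response-map : (Cl : Closure ℓ) (Cl′ : Closure ℓ′) → P ⇒ Q → (∀ {z u} → Cl z P u ⇒ Cl′ z Q u) →
                 Response Cl x y P s t a s′ → Response Cl′ x y Q s t a s′
  Response-map _ _ f g (inj₁ (a≡τ , s′Pt)) = inj₁ (a≡τ , f s′Pt)
  Response-map _ _ f g (inj₂ (t₁ , t₂ , t′ , c₁ , t₁→t₂ , c₂ , s′Pt′)) =
    inj₂ (t₁ , t₂ , t′ , g c₁ , t₁→t₂ , g c₂ , f s′Pt′)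

  Transfer⟹⇒Transfer↠ : Transfer⟹ x y R → Transfer↠ x y R
  Transfer⟹⇒Transfer↠ R-transfer sRt s→s′ =
    Response-map ⟹⟨_,_,_⟩ ↠⟨_,_,_⟩ id (⟹⟨⟩⇒↠⟨⟩ _) (R-transfer sRt s→s′)

  ↠-transfer : Transfer↠ x y R → R s t → s ↠τ s′ → ∃[ t′ ] (t ↠τ t′ × R s′ t′)
  ↠-transfer R-transfer sRt ε = _ , ε , sRt
  ↠-transfer R-transfer sRt (s→s₁ ◅ s₁↠s′) with R-transfer sRt s→s₁
  ... | inj₁ (_ , s₁Rt) = ↠-transfer R-transfer s₁Rt s₁↠s′
  ... | inj₂ (t₁ , t₂ , t₃ , c₁ , t₁→t₂ , c₂ , s₁Rt₃) with ↠-transfer R-transfer s₁Rt₃ s₁↠s′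
  ...   | t′ , t₃↠t′ , s′Rt′ = t′ , ↠⟨⟩⇒↠ c₁ ◅◅ t₁→t₂ ◅ ↠⟨⟩⇒↠ c₂ ◅◅ t₃↠t′ , s′Rt′

  Between : Rel ℓ → Rel (ℓs ⊔ ℓt ⊔ ℓ)
  Between P s u = (∃[ t ] (P s t × t ↠τ u)) × (∃[ t₁ ] (u ↠τ t₁ × P s t₁))

  data Stutter (P : Rel ℓ) : Rel (ℓs ⊔ ℓt ⊔ ℓ) where
    base     : P u v → Stutter P u v
    between  : Between P u v → Stutter P u v
    between˘ : Between P v u → Stutter P u v

  ↠⇒TauPathRel-Between : P s t → t ↠τ t₁ → P s t₁ → TauPathRel L (Between P) s t t₁
  ↠⇒TauPathRel-Between {P = P} {s = s} {t = t} {t₁ = t₁} sPt t↠t₁ sPt₁ = go ε t↠t₁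
    where
      go : t ↠τ v → v ↠τ t₁ → TauPathRel L (Between P) s v t₁
      go t↠v ε = done ((t , sPt , t↠v) , (t₁ , ε , sPt₁))
      go t↠v (v→v′ ◅ v′↠t₁) =
        step ((t , sPt , t↠v) , (t₁ , v→v′ ◅ v′↠t₁ , sPt₁)) v→v′ (go (t↠v ◅◅ v→v′ ◅ ε) v′↠t₁)

  module _ {R : Rel (ℓs ⊔ ℓt)} (R-sym : Symmetric₂ L R) (R-transfer : Transfer↠ x y R) where

    Stutter-sym : Symmetric₂ L (Stutter R)
    Stutter-sym (base sRt) = base (R-sym sRt)
    Stutter-sym (between β) = between˘ β
    Stutter-sym (between˘ β) = between β

    Between-transfer : Between R s u → s ─[ a ]→ s′ → Response ↠⟨_,_,_⟩ x y (Stutter R) s u a s′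
    Between-transfer β@((t , sRt , t↠u) , (t₁ , u↠t₁ , sRt₁)) s→s′ with R-transfer sRt₁ s→s′
    ... | inj₂ (t₂ , t₃ , t′ , c₁ , t₂→t₃ , c₂ , s′Rt′) =
      inj₂ (t₂ , t₃ , t′ ,
            ↠⟨⟩-prepend (between β) u↠t₁ (↠⟨⟩-mono base c₁) ,
            t₂→t₃ , ↠⟨⟩-mono base c₂ , base s′Rt′)
    ... | inj₁ (refl , s′Rt₁) with ↠-unsnoc u↠t₁
    ...   | inj₁ refl = inj₁ (refl , base s′Rt₁)
    ...   | inj₂ (u₁ , u↠u₁ , u₁→t₁) =
      inj₂ (u₁ , t₁ , t₁ ,
            ↠⇒↠⟨⟩ (between β) (between ((t , sRt , t↠u ◅◅ u↠u₁) , (t₁ , u₁→t₁ ◅ ε , sRt₁))) u↠u₁ ,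
            u₁→t₁ , ↠⇒↠⟨⟩ (base s′Rt₁) (base s′Rt₁) ε , base s′Rt₁)

    -- By induction on t ↠ w: s answers the first τ-step of t, and the state it
    -- reaches takes over the role of s.
    flip-Between-transfer : R s t → t ↠τ w → ∃[ t₁ ] (w ↠τ t₁ × R s t₁) → w ─[ a ]→ w′ →
                            Response ↠⟨_,_,_⟩ x y (Stutter R) w s a w′
    flip-Between-transfer sRt ε _ w→w′ =
      Response-map ↠⟨_,_,_⟩ ↠⟨_,_,_⟩ base (↠⟨⟩-mono base) (R-transfer (R-sym sRt) w→w′)
    flip-Between-transfer {s = s} {t = t} {w = w} {a = a} {w′ = w′}
                          sRt (_◅_ {j = t′} t→t′ t′↠w) (t₁ , w↠t₁ , sRt₁) w→w′ =
      [ (λ (_ , t′Rs) → flip-Between-transfer (R-sym t′Rs) t′↠w (t₁ , w↠t₁ , sRt₁) w→w′) , respond ]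
        (R-transfer (R-sym sRt) t→t′)
      where
        catch-up : s ↠τ v → ∃[ t₁′ ] (w ↠τ t₁′ × R v t₁′)
        catch-up s↠v with ↠-transfer R-transfer sRt₁ s↠v
        ... | t₁′ , t₁↠t₁′ , vRt₁′ = t₁′ , w↠t₁ ◅◅ t₁↠t₁′ , vRt₁′

        partner : s ↠τ v → R t v → Stutter R w v
        partner s↠v tRv = between˘ ((t , R-sym tRv , t→t′ ◅ t′↠w) , catch-up s↠v)

        respond : ∃[ s₁ ] ∃[ s₂ ] ∃[ s₃ ] (↠⟨ x , R , t ⟩ s s₁ × s₁ ─[ τ ]→ s₂ × ↠⟨ y , R , t′ ⟩ s₂ s₃ × R t′ s₃) →
                  Response ↠⟨_,_,_⟩ x y (Stutter R) w s a w′
        respond (s₁ , s₂ , s₃ , c₁ , s₁→s₂ , c₂ , t′Rs₃) with ↠⟨⟩-pivot {Q = Stutter R} c₂ t′Rs₃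
        ... | ŝ , s₂↠ŝ , t′Rŝ , close
          with flip-Between-transfer (R-sym t′Rŝ) t′↠w (catch-up (↠⟨⟩⇒↠ c₁ ◅◅ s₁→s₂ ◅ s₂↠ŝ)) w→w′
        ...   | inj₁ (refl , w′Sŝ) = inj₂ (s₁ , s₂ , ŝ , ↠⟨⟩-map partner c₁ , s₁→s₂ , close w′Sŝ , w′Sŝ)
        ...   | inj₂ (q₁ , q₂ , q′ , d₁ , q₁→q₂ , d₂ , w′Sq′) =
          inj₂ (q₁ , q₂ , q′ , ↠⟨⟩-prepend (partner ε (R-sym sRt)) (↠⟨⟩⇒↠ c₁ ◅◅ s₁→s₂ ◅ s₂↠ŝ) d₁ ,
                q₁→q₂ , d₂ , w′Sq′)

    Stutter-transfer : Transfer↠ x y (Stutter R)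
    Stutter-transfer (base sRt) s→s′ =
      Response-map ↠⟨_,_,_⟩ ↠⟨_,_,_⟩ base (↠⟨⟩-mono base) (R-transfer sRt s→s′)
    Stutter-transfer (between β) s→s′ = Between-transfer β s→s′
    Stutter-transfer (between˘ ((t , sRt , t↠w) , below)) w→w′ = flip-Between-transfer sRt t↠w below w→w′

  Stutter-isBisim : {R : Rel (ℓs ⊔ ℓt)} → IsGenericBisim L x y R → IsGenericBisim L x y (Stutter R)
  Stutter-isBisim (R-sym , R-transfer) = Stutter-sym R-sym R-transfer , Stutter-transfer R-sym R-transfer

  Stutterⁿ : ℕ → Rel (ℓs ⊔ ℓt) → Rel (ℓs ⊔ ℓt)
  Stutterⁿ zero R = R
  Stutterⁿ (suc k) R = Stutter (Stutterⁿ k R)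

  Stutter^ω : Rel (ℓs ⊔ ℓt) → Rel (ℓs ⊔ ℓt)
  Stutter^ω R u v = ∃[ k ] Stutterⁿ k R u v

  Stutterⁿ-isBisim : {R : Rel (ℓs ⊔ ℓt)} → IsGenericBisim L x y R → ∀ k → IsGenericBisim L x y (Stutterⁿ k R)
  Stutterⁿ-isBisim R-bisim zero = R-bisim
  Stutterⁿ-isBisim R-bisim (suc k) = Stutter-isBisim (Stutterⁿ-isBisim R-bisim k)

  ↠⟨⟩-Stutterⁿ⇒⟹⟨⟩-Stutter^ω : {R : Rel (ℓs ⊔ ℓt)} → ∀ k z →
                               ↠⟨ z , Stutterⁿ k R , u ⟩ ⇒ ⟹⟨ z , Stutter^ω R , u ⟩
  ↠⟨⟩-Stutterⁿ⇒⟹⟨⟩-Stutter^ω k o (lift s↠s′) = lift s↠s′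
  ↠⟨⟩-Stutterⁿ⇒⟹⟨⟩-Stutter^ω k b (lift (s↠s′ , uRs , uRs′)) =
    TauPathRel-mono (λ β → suc k , between β) (↠⇒TauPathRel-Between uRs s↠s′ uRs′)

  Stutter^ω-isBisim⟹ : {R : Rel (ℓs ⊔ ℓt)} → IsGenericBisim L x y R → IsGenericBisim⟹ L x y (Stutter^ω R)
  Stutter^ω-isBisim⟹ R-bisim =
    (λ (k , uRv) → k , Stutterⁿ-isBisim R-bisim k .proj₁ uRv) ,
    λ (k , sRt) s→s′ → Response-map ↠⟨_,_,_⟩ ⟹⟨_,_,_⟩ (k ,_) (↠⟨⟩-Stutterⁿ⇒⟹⟨⟩-Stutter^ω k _)
                         (Stutterⁿ-isBisim R-bisim k .proj₂ sRt s→s′)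

theorem4p9 : {ℓs ℓa ℓt : Level} (L : LTS ℓs ℓa ℓt) (x y : Mode) (s̄ t̄ : LTS.State L) →
    GenBisimilar L x y s̄ t̄ ⇔ (∃[ R ] (IsGenericBisim⟹ L {ℓs ⊔ ℓt} x y R × R s̄ t̄))
theorem4p9 L x y s̄ t̄ = mk⇔
  (λ (R , R-bisim , s̄Rt̄) → Stutter^ω L R , Stutter^ω-isBisim⟹ L R-bisim , 0 , s̄Rt̄)
  (λ (R , (R-sym , R-transfer) , s̄Rt̄) → R , (R-sym , Transfer⟹⇒Transfer↠ L R-transfer) , s̄Rt̄)
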